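{- Each of the following three permutation statistics is Mahonian: (1) $(a-cb)+(b-ac)+(c-ba)+(ba)$; (2) $(b-ac)+(b-ca)+(c-ba)+(ba)$; (3) $(a-cb)+(c-ab)+(c-ba)+(ba)$. That is, for each of them, every $n\ge1$ and every integer $k$, the number of $\pi\in\mathfrak S_n$ on which the statistic equals $k$ equals the number of $\pi\in\mathfrak S_n$ with $\mathrm{inv}\,\pi=k$.
   Context: $\mathfrak S_n$ is the set of permutations $\pi=\pi_1\cdots\pi_n$ of $\{1,\dots,n\}$; $\mathrm{inv}\,\pi=\#\{(i,j):1\le i<j\le n,\ \pi_i>\pi_j\}$. Vincular patterns are words over letters $a<b<c$ possibly containing dashes. An occurrence of a pattern $p=p_1\cdots p_k$ (letters, ignoring dashes) in $\pi$ is a sequence of positions $i_1<\dots<i_k$ such that $\pi_{i_1}\cdots\pi_{i_k}$ is order-isomorphic to $p_1\cdots p_k$, with $i_{r+1}=i_r+1$ whenever the $r$-th and $(r+1)$-st letters are not separated by a dash. $(\sigma+\tau+\cdots)\,\pi$ is the total number of occurrences of the listed patterns. E.g. $(c-ab)\,\pi=\#\{(i,j):i<j<n,\ \pi_j<\pi_{j+1}<\pi_i\}$ and $(ba)\,\pi=\#\{i<n:\pi_i>\pi_{i+1}\}$. -}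

module Defs where

open import Data.Bool using (Bool; true; false; if_then_else_; _∧_; not)
open import Data.Nat using (ℕ; zero; suc; _+_; _<ᵇ_; _≡ᵇ_)
open import Data.Fin using (Fin; toℕ)
open import Data.List using (List; []; _∷_; map; concatMap; filter; length; allFin)
open import Data.Nat.ListAction using (sum)
open import Data.Bool.ListAction using (all)
open import Data.Vec using (Vec; []; _∷_; toList)
open import Data.Integer using (ℤ; +_)
import Data.Integer.Properties as ℤP
open import Relation.Nullary.Decidable using (⌊_⌋; does)
import Relation.Binary.PropositionalEquality

-- Elements of 𝔖ₙ are encoded as vectors in Vec (Fin n) n with
-- pairwise distinct entries (values 0,…,n-1 instead of 1,…,n; all notions
-- below only depend on the relative order of the entries).

words : (n m : ℕ) → List (Vec (Fin n) m)
words n zero    = [] ∷ []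
words n (suc m) = concatMap (λ x → map (x ∷_) (words n m)) (allFin n)

distinct : List ℕ → Bool
distinct []      = true
distinct (x ∷ t) = all (λ y → not (x ≡ᵇ y)) t ∧ distinct t

oneLine : ∀ {n} → Vec (Fin n) n → List ℕ
oneLine v = toList (Data.Vec.map toℕ v)

Sym : ℕ → List (List ℕ)
Sym n = filter (λ w → Data.Bool._≟_ (distinct w) true) (map oneLine (words n n))

Stat : Set
Stat = List ℕ → ℕ

b2n : Bool → ℕ
b2n true  = 1
b2n false = 0

inv : Stat
inv []      = 0
inv (x ∷ t) = sum (map (λ y → b2n (y <ᵇ x)) t) + inv t

ba : Stat
ba []          = 0
ba (x ∷ [])    = 0
ba (x ∷ y ∷ t) = b2n (y <ᵇ x) + ba (y ∷ t)

-- occurrences of a pattern  p₁-p₂p₃ :  positions i < j < j+1 such that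
-- (πᵢ, πⱼ, πⱼ₊₁) satisfies the order predicate Q.
adjCount : (ℕ → ℕ → Bool) → List ℕ → ℕ
adjCount Q []          = 0
adjCount Q (y ∷ [])    = 0
adjCount Q (y ∷ z ∷ t) = b2n (Q y z) + adjCount Q (z ∷ t)

dashPat : (ℕ → ℕ → ℕ → Bool) → Stat
dashPat Q []      = 0
dashPat Q (x ∷ t) = adjCount (Q x) t + dashPat Q t

-- x-yz order-isomorphic to the given pattern over a<b<c
a-cb b-ac c-ba b-ca c-ab : Stat
a-cb = dashPat (λ x y z → (x <ᵇ z) ∧ (z <ᵇ y))
b-ac = dashPat (λ x y z → (y <ᵇ x) ∧ (x <ᵇ z))
c-ba = dashPat (λ x y z → (z <ᵇ y) ∧ (y <ᵇ x))
b-ca = dashPat (λ x y z → (z <ᵇ x) ∧ (x <ᵇ y))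
c-ab = dashPat (λ x y z → (y <ᵇ z) ∧ (z <ᵇ x))

stat1 stat2 stat3 : Stat
stat1 w = a-cb w + b-ac w + c-ba w + ba w
stat2 w = b-ac w + b-ca w + c-ba w + ba w
stat3 w = a-cb w + c-ab w + c-ba w + ba w

count : Stat → ℕ → ℤ → ℕ
count st n k = length (filter (λ w → (+ st w) ℤP.≟ k) (Sym n))

Mahonian : Stat → Set
Mahonian st = ∀ (n : ℕ) → 1 Data.Nat.≤ n → ∀ (k : ℤ) → count st n k Relation.Binary.PropositionalEquality.≡ count inv n k

-- Every permutation of {0, …, n} arises exactly once by appending a new last value g ≤ n to some
-- σ ∈ 𝔖ₙ whose values ≥ g are shifted up by one.  A new occurrence of a pattern x-yz must use the
-- last two letters, so each statistic grows by a count of values in an interval determined by g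
-- and by the last value r of σ; writing n = r + 1 + k, stat1 for instance grows by k + 1 + g when
-- g ≤ r and by g − r − 1 when g > r.  For all three statistics, as for inv, the increments over
-- g = 0, …, n are 0, …, n in some order, so by induction on n each statistic takes the same
-- multiset of values on 𝔖ₙ as inv.

module Submission where

open import Defs
open import Data.Bool using (Bool; true; false; _∧_; not; T)
import Data.Bool as Bool
open import Data.Bool.Properties using (∧-identityʳ; ∧-zeroʳ; T-≡; T-not-≡; T-∧)
open import Data.Empty using (⊥-elim)
open import Data.Fin using (Fin; toℕ; fromℕ<)
import Data.Fin.Properties as FinP
import Data.Integer as ℤ
open import Data.Integer.Properties using () renaming (_≟_ to _ℤ≟_)
open import Data.List
  using (List; []; _∷_; [_]; _++_; _∷ʳ_; map; concatMap; allFin; cartesianProductWith; reverse;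
         upTo; downFrom; applyUpTo; length; filter; initLast; _∷ʳ′_)
open import Data.List.Properties
  using (∷-injective; ∷ʳ-injective; map-++; map-∘; map-id; map-cong; map-cong-local; map-injective;
         length-map; map-upTo; length-upTo; reverse-upTo)
open import Data.List.Membership.Propositional using (_∈_)
open import Data.List.Membership.Propositional.Properties
  using (∈-++⁺ʳ; ∈-upTo⁻; ∈-upTo⁺; ∈-allFin; ∈-filter⁺; ∈-filter⁻; ∈-map⁺; ∈-map⁻;
         ∈-cartesianProductWith⁺; ∈-cartesianProductWith⁻)
open import Data.List.Membership.Propositional.Properties.WithK using (unique∧set⇒bag)
open import Data.List.Relation.Binary.BagAndSetEquality using (∼bag⇒↭)
open import Data.List.Relation.Binary.Permutation.Propositional
  using (_↭_; ↭⇒↭ₛ; ↭-refl; ↭-prep; ↭-sym; ↭-trans; ↭-reflexive; module PermutationReasoning)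
import Data.List.Relation.Binary.Permutation.Propositional as ↭
open import Data.List.Relation.Binary.Permutation.Propositional.Properties
  using (map⁺; filter-↭; All-resp-↭; ++-comm; ++⁺; ++⁺ˡ; ++⁺ʳ; shifts; ↭-reverse; ∷↭∷ʳ;
         ↭-empty-inv; ↭-length; ∈-resp-↭)
open import Data.List.Relation.Unary.All using (All; []; _∷_)
import Data.List.Relation.Unary.All as All
import Data.List.Relation.Unary.All.Properties as AllP
open import Data.List.Relation.Unary.AllPairs using ([]; _∷_)
open import Data.List.Relation.Unary.Any using (here)
open import Data.List.Relation.Unary.Unique.Propositional using (Unique)
import Data.List.Relation.Unary.Unique.Propositional.Properties as UniqueP
open import Data.Nat using (ℕ; zero; suc; pred; _+_; _∸_; _<ᵇ_; _≤ᵇ_; _≡ᵇ_; _≤_; _<_; z≤n; s≤s)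
open import Data.Nat.ListAction using (sum)
open import Data.Nat.ListAction.Properties using (sum-++; sum-↭)
open import Data.Nat.Properties
open import Data.Nat.Tactic.RingSolver using (solve-∀)
open import Data.Product using (_×_; _,_; proj₁; ∃)
open import Data.Unit using (tt)
open import Data.Vec using (Vec; []; _∷_)
import Data.Vec as Vec
import Data.Vec.Properties as VecP
open import Function using (_∘_)
open import Function.Bundles using (Equivalence; mk⇔)
open import Relation.Binary.PropositionalEquality hiding ([_])
open import Relation.Nullary using (Dec; does; contradiction)

open import Algebra.Properties.CommutativeSemigroup +-commutativeSemigroup using (interchange)
open import Data.List.Relation.Binary.Permutation.Setoid.Properties (setoid ℕ) using (Unique-resp-↭)

-- Boolean comparisons, and the order embedding punchIn g of ℕ onto ℕ ∖ {g}

<ᵇ-true : ∀ {m n} → m < n → (m <ᵇ n) ≡ true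
<ᵇ-true {zero} (s≤s _) = refl
<ᵇ-true {suc m} (s≤s m<n@(s≤s _)) = <ᵇ-true m<n

<ᵇ-false : ∀ {m n} → n ≤ m → (m <ᵇ n) ≡ false
<ᵇ-false z≤n = refl
<ᵇ-false (s≤s n≤m) = <ᵇ-false n≤m

<ᵇ-irrefl : ∀ n → (n <ᵇ n) ≡ false
<ᵇ-irrefl n = <ᵇ-false {n} ≤-refl

≤ᵇ-true : ∀ {m n} → m ≤ n → (m ≤ᵇ n) ≡ true
≤ᵇ-true z≤n = refl
≤ᵇ-true m≤n@(s≤s _) = <ᵇ-true m≤n

≤ᵇ-false : ∀ {m n} → n < m → (m ≤ᵇ n) ≡ false
≤ᵇ-false (s≤s n≤m) = <ᵇ-false n≤m

≤ᵇ-<ᵇ-suc : ∀ m n → (m ≤ᵇ n) ≡ (m <ᵇ suc n)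
≤ᵇ-<ᵇ-suc zero n = refl
≤ᵇ-<ᵇ-suc (suc m) n = refl

T-not-≡ᵇ⇒≢ : ∀ {x y} → T (not (x ≡ᵇ y)) → x ≢ y
T-not-≡ᵇ⇒≢ {x} {y} t x≡y = subst T (Equivalence.to T-not-≡ t) (≡⇒≡ᵇ x y x≡y)

≢⇒T-not-≡ᵇ : ∀ {x y} → x ≢ y → T (not (x ≡ᵇ y))
≢⇒T-not-≡ᵇ {x} {y} x≢y with x ≡ᵇ y in eq
... | false = tt
... | true  = x≢y (≡ᵇ⇒≡ x y (subst T (sym eq) tt))

punchIn : ℕ → ℕ → ℕ
punchIn zero    x       = suc x
punchIn (suc g) zero    = zero
punchIn (suc g) (suc x) = suc (punchIn g x)

punchOut : ℕ → ℕ → ℕ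
punchOut zero    x       = pred x
punchOut (suc g) zero    = zero
punchOut (suc g) (suc x) = suc (punchOut g x)

punchIn-<ᵇ : ∀ g x y → (punchIn g x <ᵇ punchIn g y) ≡ (x <ᵇ y)
punchIn-<ᵇ zero    x       y       = refl
punchIn-<ᵇ (suc g) zero    zero    = refl
punchIn-<ᵇ (suc g) zero    (suc y) = refl
punchIn-<ᵇ (suc g) (suc x) zero    = refl
punchIn-<ᵇ (suc g) (suc x) (suc y) = punchIn-<ᵇ g x y

punchIn-<ᵇ-pivot : ∀ g x → (punchIn g x <ᵇ g) ≡ (x <ᵇ g)
punchIn-<ᵇ-pivot zero    x       = refl
punchIn-<ᵇ-pivot (suc g) zero    = refl
punchIn-<ᵇ-pivot (suc g) (suc x) = punchIn-<ᵇ-pivot g x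

pivot-<ᵇ-punchIn : ∀ g x → (g <ᵇ punchIn g x) ≡ (g ≤ᵇ x)
pivot-<ᵇ-punchIn zero    x       = refl
pivot-<ᵇ-punchIn (suc g) zero    = refl
pivot-<ᵇ-punchIn (suc g) (suc x) = trans (pivot-<ᵇ-punchIn g x) (≤ᵇ-<ᵇ-suc g x)

punchIn-injective : ∀ g {x y} → punchIn g x ≡ punchIn g y → x ≡ y
punchIn-injective zero    eq = suc-injective eq
punchIn-injective (suc g) {zero}  {zero}  eq = refl
punchIn-injective (suc g) {suc x} {suc y} eq = cong suc (punchIn-injective g (suc-injective eq))

punchIn-punchOut : ∀ {g x} → x ≢ g → punchIn g (punchOut g x) ≡ x
punchIn-punchOut {zero}  {zero}  x≢g = ⊥-elim (x≢g refl)
punchIn-punchOut {zero}  {suc x} x≢g = refl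
punchIn-punchOut {suc g} {zero}  x≢g = refl
punchIn-punchOut {suc g} {suc x} x≢g = cong suc (punchIn-punchOut (x≢g ∘ cong suc))

punchOut-< : ∀ {m g x} → g < suc m → x < suc m → x ≢ g → punchOut g x < m
punchOut-< {m}     {zero}  {zero}  _ _ x≢g = ⊥-elim (x≢g refl)
punchOut-< {m}     {zero}  {suc x} _ (s≤s x<m) _ = x<m
punchOut-< {suc m} {suc g} {zero}  _ _ _ = s≤s z≤n
punchOut-< {zero}  {suc g} (s≤s ())
punchOut-< {suc m} {suc g} {suc x} (s≤s g<) (s≤s x<) x≢g = s≤s (punchOut-< g< x< (x≢g ∘ cong suc))

upTo-suc : ∀ n → upTo (suc n) ≡ 0 ∷ map suc (upTo n)
upTo-suc n = cong (0 ∷_) (sym (map-upTo suc n))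

upTo-+ : ∀ m n → upTo (m + n) ≡ upTo m ++ map (m +_) (upTo n)
upTo-+ zero    n = sym (map-id (upTo n))
upTo-+ (suc m) n = begin
  upTo (suc m + n)                                         ≡⟨ upTo-suc (m + n) ⟩
  0 ∷ map suc (upTo (m + n))                               ≡⟨ cong (λ xs → 0 ∷ map suc xs) (upTo-+ m n) ⟩
  0 ∷ map suc (upTo m ++ map (m +_) (upTo n))              ≡⟨ cong (0 ∷_) (map-++ suc (upTo m) _) ⟩
  0 ∷ map suc (upTo m) ++ map suc (map (m +_) (upTo n))    ≡⟨ cong (λ xs → 0 ∷ map suc (upTo m) ++ xs) (map-∘ (upTo n)) ⟨
  0 ∷ map suc (upTo m) ++ map (suc m +_) (upTo n)          ≡⟨ cong₂ _++_ (upTo-suc m) refl ⟨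
  upTo (suc m) ++ map (suc m +_) (upTo n)                  ∎
  where open ≡-Reasoning

map-upTo-+ : ∀ {A : Set} (f : ℕ → A) m n → map f (upTo (m + n)) ≡ map f (upTo m) ++ map (λ i → f (m + i)) (upTo n)
map-upTo-+ f m n = begin
  map f (upTo (m + n))                               ≡⟨ cong (map f) (upTo-+ m n) ⟩
  map f (upTo m ++ map (m +_) (upTo n))              ≡⟨ map-++ f (upTo m) _ ⟩
  map f (upTo m) ++ map f (map (m +_) (upTo n))      ≡⟨ cong (map f (upTo m) ++_) (map-∘ (upTo n)) ⟨
  map f (upTo m) ++ map (λ i → f (m + i)) (upTo n)   ∎
  where open ≡-Reasoning

map-cong-upTo : ∀ {A : Set} {f h : ℕ → A} n → (∀ {i} → i < n → f i ≡ h i) → map f (upTo n) ≡ map h (upTo n)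
map-cong-upTo n eq = map-cong-local (AllP.applyUpTo⁺₁ (λ i → i) n eq)

applyUpTo-reflect : ∀ m → applyUpTo (m ∸_) (suc m) ≡ downFrom (suc m)
applyUpTo-reflect zero    = refl
applyUpTo-reflect (suc m) = cong (suc m ∷_) (applyUpTo-reflect m)

map-upTo-reflect : ∀ {A : Set} (h : ℕ → A) m → map (λ i → h (m ∸ i)) (upTo (suc m)) ↭ map h (upTo (suc m))
map-upTo-reflect h m = begin
  map (λ i → h (m ∸ i)) (upTo (suc m))   ≡⟨ map-∘ (upTo (suc m)) ⟩
  map h (map (m ∸_) (upTo (suc m)))      ≡⟨ cong (map h) (trans (map-upTo (m ∸_) (suc m)) (applyUpTo-reflect m)) ⟩
  map h (downFrom (suc m))               ≡⟨ cong (map h) (reverse-upTo (suc m)) ⟨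
  map h (reverse (upTo (suc m)))         ↭⟨ map⁺ h (↭-reverse (upTo (suc m))) ⟩
  map h (upTo (suc m))                   ∎
  where open PermutationReasoning

concatMap-map≡cartesianProductWith : ∀ {A B C : Set} (f : A → B → C) xs ys →
  concatMap (λ x → map (f x) ys) xs ≡ cartesianProductWith f xs ys
concatMap-map≡cartesianProductWith f []       ys = refl
concatMap-map≡cartesianProductWith f (x ∷ xs) ys = cong (map (f x) ys ++_) (concatMap-map≡cartesianProductWith f xs ys)

cartesianProductWith-↭ˡ : ∀ {A B C : Set} (f : A → B → C) {xs ys} zs → xs ↭ ys →
  cartesianProductWith f xs zs ↭ cartesianProductWith f ys zs
cartesianProductWith-↭ˡ f zs ↭.refl         = ↭-refl
cartesianProductWith-↭ˡ f zs (↭.prep x p)   = ++⁺ˡ (map (f x) zs) (cartesianProductWith-↭ˡ f zs p)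
cartesianProductWith-↭ˡ f zs (↭.swap x y p) =
  ↭-trans (shifts (map (f x) zs) (map (f y) zs)) (++⁺ˡ (map (f y) zs) (++⁺ˡ (map (f x) zs) (cartesianProductWith-↭ˡ f zs p)))
cartesianProductWith-↭ˡ f zs (↭.trans p q)  = ↭-trans (cartesianProductWith-↭ˡ f zs p) (cartesianProductWith-↭ˡ f zs q)

length-filter-map : ∀ {A B : Set} {P : B → Set} (P? : ∀ b → Dec (P b)) (f : A → B) xs →
  length (filter (P? ∘ f) xs) ≡ length (filter P? (map f xs))
length-filter-map P? f []       = refl
length-filter-map P? f (x ∷ xs) with does (P? (f x))
... | true  = cong suc (length-filter-map P? f xs)
... | false = length-filter-map P? f xs

countᵇ : (ℕ → Bool) → List ℕ → ℕ
countᵇ P xs = sum (map (λ x → b2n (P x)) xs)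

countᵇ-∷ʳ : ∀ P xs x → countᵇ P (xs ∷ʳ x) ≡ countᵇ P xs + b2n (P x)
countᵇ-∷ʳ P xs x = begin
  sum (map (λ x → b2n (P x)) (xs ++ [ x ]))  ≡⟨ cong sum (map-++ (λ x → b2n (P x)) xs [ x ]) ⟩
  sum (map (λ x → b2n (P x)) xs ++ [ b2n (P x) ]) ≡⟨ sum-++ (map (λ x → b2n (P x)) xs) _ ⟩
  countᵇ P xs + (b2n (P x) + 0)              ≡⟨ cong (countᵇ P xs +_) (+-identityʳ _) ⟩
  countᵇ P xs + b2n (P x)                    ∎
  where open ≡-Reasoning

countᵇ-cong : ∀ {P P′} xs → (∀ x → P x ≡ P′ x) → countᵇ P xs ≡ countᵇ P′ xs
countᵇ-cong xs eq = cong sum (map-cong (cong b2n ∘ eq) xs)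

countᵇ-map : ∀ P f xs → countᵇ P (map f xs) ≡ countᵇ (P ∘ f) xs
countᵇ-map P f xs = cong sum (sym (map-∘ xs))

countᵇ-↭ : ∀ P {xs ys} → xs ↭ ys → countᵇ P xs ≡ countᵇ P ys
countᵇ-↭ P p = sum-↭ (map⁺ (λ x → b2n (P x)) p)

countᵇ-false : ∀ {P} xs → (∀ x → P x ≡ false) → countᵇ P xs ≡ 0
countᵇ-false []       _   = refl
countᵇ-false (x ∷ xs) P≡f rewrite P≡f x = countᵇ-false xs P≡f

countᵇ-∧-falseˡ : ∀ {c} (P : ℕ → Bool) xs → c ≡ false → countᵇ (λ x → c ∧ P x) xs ≡ 0
countᵇ-∧-falseˡ P xs refl = countᵇ-false xs (λ _ → refl)

countᵇ-∧-falseʳ : ∀ {c} (P : ℕ → Bool) xs → c ≡ false → countᵇ (λ x → P x ∧ c) xs ≡ 0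
countᵇ-∧-falseʳ P xs refl = countᵇ-false xs (λ x → ∧-zeroʳ (P x))

countᵇ-∧-trueʳ : ∀ {c} (P : ℕ → Bool) xs → c ≡ true → countᵇ (λ x → P x ∧ c) xs ≡ countᵇ P xs
countᵇ-∧-trueʳ P xs refl = countᵇ-cong xs (λ x → ∧-identityʳ (P x))

countᵇ-upTo-suc : ∀ P n → countᵇ P (upTo (suc n)) ≡ b2n (P 0) + countᵇ (P ∘ suc) (upTo n)
countᵇ-upTo-suc P n = trans (cong (countᵇ P) (upTo-suc n)) (cong (b2n (P 0) +_) (countᵇ-map P suc (upTo n)))

countᵇ-from : ∀ a n → countᵇ (a ≤ᵇ_) (upTo n) ≡ n ∸ a
countᵇ-from zero    zero    = refl
countᵇ-from zero    (suc n) = trans (countᵇ-upTo-suc (0 ≤ᵇ_) n) (cong suc (countᵇ-from zero n))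
countᵇ-from (suc a) zero    = refl
countᵇ-from (suc a) (suc n) = begin
  countᵇ (suc a ≤ᵇ_) (upTo (suc n))   ≡⟨ countᵇ-upTo-suc (suc a ≤ᵇ_) n ⟩
  countᵇ (λ x → a <ᵇ suc x) (upTo n)  ≡⟨ countᵇ-cong (upTo n) (λ x → ≤ᵇ-<ᵇ-suc a x) ⟨
  countᵇ (a ≤ᵇ_) (upTo n)             ≡⟨ countᵇ-from a n ⟩
  n ∸ a                               ∎
  where open ≡-Reasoning

countᵇ-between : ∀ a {b n} → b ≤ n → countᵇ (λ x → (a ≤ᵇ x) ∧ (x <ᵇ b)) (upTo n) ≡ b ∸ a
countᵇ-between zero    {zero}  {n}     _         = countᵇ-false (upTo n) (λ _ → refl)
countᵇ-between (suc a) {zero}  {n}     _         = countᵇ-false (upTo n) (λ x → ∧-zeroʳ (suc a ≤ᵇ x))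
countᵇ-between zero    {suc b} {suc n} (s≤s b≤n) = trans (countᵇ-upTo-suc (_<ᵇ suc b) n) (cong suc (countᵇ-between zero b≤n))
countᵇ-between (suc a) {suc b} {suc n} (s≤s b≤n) = begin
  countᵇ (λ x → (suc a ≤ᵇ x) ∧ (x <ᵇ suc b)) (upTo (suc n))
    ≡⟨ countᵇ-upTo-suc (λ x → (suc a ≤ᵇ x) ∧ (x <ᵇ suc b)) n ⟩
  countᵇ (λ x → (a <ᵇ suc x) ∧ (x <ᵇ b)) (upTo n)
    ≡⟨ countᵇ-cong (upTo n) (λ x → cong (_∧ (x <ᵇ b)) (≤ᵇ-<ᵇ-suc a x)) ⟨
  countᵇ (λ x → (a ≤ᵇ x) ∧ (x <ᵇ b)) (upTo n)
    ≡⟨ countᵇ-between a b≤n ⟩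
  b ∸ a ∎
  where open ≡-Reasoning

-- Growth of the statistics when a new last value is appended

OrderPreserving : (ℕ → ℕ) → Set
OrderPreserving f = ∀ x y → (f x <ᵇ f y) ≡ (x <ᵇ y)

inv-map : ∀ {f} → OrderPreserving f → ∀ w → inv (map f w) ≡ inv w
inv-map f-mono []      = refl
inv-map {f} f-mono (x ∷ w) = cong₂ _+_
  (trans (countᵇ-map (_<ᵇ f x) f w) (countᵇ-cong w (λ y → f-mono y x)))
  (inv-map f-mono w)

inv-∷ʳ : ∀ w z → inv (w ∷ʳ z) ≡ inv w + countᵇ (z <ᵇ_) w
inv-∷ʳ []      z = refl
inv-∷ʳ (x ∷ w) z rewrite countᵇ-∷ʳ (_<ᵇ x) w z | inv-∷ʳ w z =
  interchange (countᵇ (_<ᵇ x) w) (b2n (z <ᵇ x)) (inv w) _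

adjCount-map : ∀ Q {Q′ f} → (∀ y z → Q (f y) (f z) ≡ Q′ y z) → ∀ w → adjCount Q (map f w) ≡ adjCount Q′ w
adjCount-map Q eq []          = refl
adjCount-map Q eq (y ∷ [])    = refl
adjCount-map Q eq (y ∷ z ∷ w) = cong₂ _+_ (cong b2n (eq y z)) (adjCount-map Q eq (z ∷ w))

adjCount-∷ʳ : ∀ Q w y z → adjCount Q (w ∷ʳ y ∷ʳ z) ≡ adjCount Q (w ∷ʳ y) + b2n (Q y z)
adjCount-∷ʳ Q []          y z = +-comm (b2n (Q y z)) 0
adjCount-∷ʳ Q (a ∷ [])    y z = trans (cong (b2n (Q a y) +_) (+-comm (b2n (Q y z)) 0)) (sym (+-assoc (b2n (Q a y)) 0 _))
adjCount-∷ʳ Q (a ∷ b ∷ w) y z = trans (cong (b2n (Q a b) +_) (adjCount-∷ʳ Q (b ∷ w) y z)) (sym (+-assoc (b2n (Q a b)) _ _))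

ba-adjCount : ∀ w → ba w ≡ adjCount (λ y z → z <ᵇ y) w
ba-adjCount []          = refl
ba-adjCount (y ∷ [])    = refl
ba-adjCount (y ∷ z ∷ w) = cong (b2n (z <ᵇ y) +_) (ba-adjCount (z ∷ w))

ba-map : ∀ {f} → OrderPreserving f → ∀ w → ba (map f w) ≡ ba w
ba-map f-mono w = begin
  ba (map _ w)                              ≡⟨ ba-adjCount (map _ w) ⟩
  adjCount (λ y z → z <ᵇ y) (map _ w)        ≡⟨ adjCount-map (λ y z → z <ᵇ y) (λ y z → f-mono z y) w ⟩
  adjCount (λ y z → z <ᵇ y) w                ≡⟨ ba-adjCount w ⟨
  ba w                                      ∎
  where open ≡-Reasoning

ba-∷ʳ : ∀ w y z → ba (w ∷ʳ y ∷ʳ z) ≡ ba (w ∷ʳ y) + b2n (z <ᵇ y)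
ba-∷ʳ w y z rewrite ba-adjCount (w ∷ʳ y ∷ʳ z) | ba-adjCount (w ∷ʳ y) = adjCount-∷ʳ _ w y z

dashPat-map : ∀ Q {f} → (∀ x y z → Q (f x) (f y) (f z) ≡ Q x y z) → ∀ w → dashPat Q (map f w) ≡ dashPat Q w
dashPat-map Q eq []      = refl
dashPat-map Q eq (x ∷ w) = cong₂ _+_ (adjCount-map (Q _) (eq x) w) (dashPat-map Q eq w)

dashPat-∷ʳ : ∀ Q w y z → dashPat Q (w ∷ʳ y ∷ʳ z) ≡ dashPat Q (w ∷ʳ y) + countᵇ (λ x → Q x y z) w
dashPat-∷ʳ Q []      y z = refl
dashPat-∷ʳ Q (a ∷ w) y z rewrite adjCount-∷ʳ (Q a) w y z | dashPat-∷ʳ Q w y z =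
  interchange (adjCount (Q a) (w ∷ʳ y)) (b2n (Q a y z)) (dashPat Q (w ∷ʳ y)) _

extend : List ℕ → ℕ → List ℕ
extend σ g = map (punchIn g) σ ∷ʳ g

extend-∷ʳ : ∀ u r g → extend (u ∷ʳ r) g ≡ map (punchIn g) u ∷ʳ punchIn g r ∷ʳ g
extend-∷ʳ u r g = cong (_∷ʳ g) (map-++ (punchIn g) u [ r ])

inv-extend : ∀ σ g → inv (extend σ g) ≡ inv σ + countᵇ (g ≤ᵇ_) σ
inv-extend σ g = begin
  inv (map (punchIn g) σ ∷ʳ g)
    ≡⟨ inv-∷ʳ (map (punchIn g) σ) g ⟩
  inv (map (punchIn g) σ) + countᵇ (g <ᵇ_) (map (punchIn g) σ)
    ≡⟨ cong₂ _+_ (inv-map (punchIn-<ᵇ g) σ) (countᵇ-map (g <ᵇ_) (punchIn g) σ) ⟩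
  inv σ + countᵇ (λ x → g <ᵇ punchIn g x) σ
    ≡⟨ cong (inv σ +_) (countᵇ-cong σ (pivot-<ᵇ-punchIn g)) ⟩
  inv σ + countᵇ (g ≤ᵇ_) σ ∎
  where open ≡-Reasoning

ba-extend : ∀ u r g → ba (extend (u ∷ʳ r) g) ≡ ba (u ∷ʳ r) + b2n (g ≤ᵇ r)
ba-extend u r g = begin
  ba (extend (u ∷ʳ r) g)
    ≡⟨ cong ba (extend-∷ʳ u r g) ⟩
  ba (map (punchIn g) u ∷ʳ punchIn g r ∷ʳ g)
    ≡⟨ ba-∷ʳ (map (punchIn g) u) (punchIn g r) g ⟩
  ba (map (punchIn g) u ∷ʳ punchIn g r) + b2n (g <ᵇ punchIn g r)
    ≡⟨ cong₂ _+_ (cong ba (map-++ (punchIn g) u [ r ])) refl ⟨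
  ba (map (punchIn g) (u ∷ʳ r)) + b2n (g <ᵇ punchIn g r)
    ≡⟨ cong₂ _+_ (ba-map (punchIn-<ᵇ g) (u ∷ʳ r)) (cong b2n (pivot-<ᵇ-punchIn g r)) ⟩
  ba (u ∷ʳ r) + b2n (g ≤ᵇ r) ∎
  where open ≡-Reasoning

dashPat-extend : ∀ Q u r g → (∀ x y z → Q (punchIn g x) (punchIn g y) (punchIn g z) ≡ Q x y z) →
  dashPat Q (extend (u ∷ʳ r) g) ≡ dashPat Q (u ∷ʳ r) + countᵇ (λ x → Q (punchIn g x) (punchIn g r) g) u
dashPat-extend Q u r g Q-inv = begin
  dashPat Q (extend (u ∷ʳ r) g)
    ≡⟨ cong (dashPat Q) (extend-∷ʳ u r g) ⟩
  dashPat Q (map (punchIn g) u ∷ʳ punchIn g r ∷ʳ g)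
    ≡⟨ dashPat-∷ʳ Q (map (punchIn g) u) (punchIn g r) g ⟩
  dashPat Q (map (punchIn g) u ∷ʳ punchIn g r) + countᵇ (λ x → Q x (punchIn g r) g) (map (punchIn g) u)
    ≡⟨ cong₂ _+_ (cong (dashPat Q) (map-++ (punchIn g) u [ r ])) refl ⟨
  dashPat Q (map (punchIn g) (u ∷ʳ r)) + countᵇ (λ x → Q x (punchIn g r) g) (map (punchIn g) u)
    ≡⟨ cong₂ _+_ (dashPat-map Q Q-inv (u ∷ʳ r)) (countᵇ-map _ (punchIn g) u) ⟩
  dashPat Q (u ∷ʳ r) + countᵇ (λ x → Q (punchIn g x) (punchIn g r) g) u ∎
  where open ≡-Reasoning

module _ (u : List ℕ) (r g : ℕ) where

  a-cb-extend : a-cb (extend (u ∷ʳ r) g) ≡ a-cb (u ∷ʳ r) + countᵇ (λ x → (x <ᵇ g) ∧ (g ≤ᵇ r)) u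
  a-cb-extend = trans (dashPat-extend _ u r g (λ x y z → cong₂ _∧_ (punchIn-<ᵇ g x z) (punchIn-<ᵇ g z y)))
    (cong (a-cb (u ∷ʳ r) +_) (countᵇ-cong u (λ x → cong₂ _∧_ (punchIn-<ᵇ-pivot g x) (pivot-<ᵇ-punchIn g r))))

  b-ac-extend : b-ac (extend (u ∷ʳ r) g) ≡ b-ac (u ∷ʳ r) + countᵇ (λ x → (r <ᵇ x) ∧ (x <ᵇ g)) u
  b-ac-extend = trans (dashPat-extend _ u r g (λ x y z → cong₂ _∧_ (punchIn-<ᵇ g y x) (punchIn-<ᵇ g x z)))
    (cong (b-ac (u ∷ʳ r) +_) (countᵇ-cong u (λ x → cong₂ _∧_ (punchIn-<ᵇ g r x) (punchIn-<ᵇ-pivot g x))))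

  c-ba-extend : c-ba (extend (u ∷ʳ r) g) ≡ c-ba (u ∷ʳ r) + countᵇ (λ x → (g ≤ᵇ r) ∧ (r <ᵇ x)) u
  c-ba-extend = trans (dashPat-extend _ u r g (λ x y z → cong₂ _∧_ (punchIn-<ᵇ g z y) (punchIn-<ᵇ g y x)))
    (cong (c-ba (u ∷ʳ r) +_) (countᵇ-cong u (λ x → cong₂ _∧_ (pivot-<ᵇ-punchIn g r) (punchIn-<ᵇ g r x))))

  b-ca-extend : b-ca (extend (u ∷ʳ r) g) ≡ b-ca (u ∷ʳ r) + countᵇ (λ x → (g ≤ᵇ x) ∧ (x <ᵇ r)) u
  b-ca-extend = trans (dashPat-extend _ u r g (λ x y z → cong₂ _∧_ (punchIn-<ᵇ g z x) (punchIn-<ᵇ g x y)))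
    (cong (b-ca (u ∷ʳ r) +_) (countᵇ-cong u (λ x → cong₂ _∧_ (pivot-<ᵇ-punchIn g x) (punchIn-<ᵇ g x r))))

  c-ab-extend : c-ab (extend (u ∷ʳ r) g) ≡ c-ab (u ∷ʳ r) + countᵇ (λ x → (r <ᵇ g) ∧ (g ≤ᵇ x)) u
  c-ab-extend = trans (dashPat-extend _ u r g (λ x y z → cong₂ _∧_ (punchIn-<ᵇ g y z) (punchIn-<ᵇ g z x)))
    (cong (c-ab (u ∷ʳ r) +_) (countᵇ-cong u (λ x → cong₂ _∧_ (punchIn-<ᵇ-pivot g r) (pivot-<ᵇ-punchIn g x))))

-- Statistics whose increments over the n + 1 extensions of σ ∈ 𝔖ₙ are 0, …, n

HasRangeIncrements : Stat → ℕ → List ℕ → Set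
HasRangeIncrements st n σ = map (λ g → st (extend σ g)) (upTo (suc n)) ↭ map (st σ +_) (upTo (suc n))

RangeIncrementing : Stat → Set
RangeIncrementing st = ∀ {n σ} → σ ↭ upTo n → HasRangeIncrements st n σ

inv-rangeIncrementing : RangeIncrementing inv
inv-rangeIncrementing {n} {σ} σ↭ = begin
  map (λ g → inv (extend σ g)) (upTo (suc n))
    ≡⟨ map-cong (λ g → trans (inv-extend σ g) (cong (inv σ +_) (countᵇ-↭ (g ≤ᵇ_) σ↭))) (upTo (suc n)) ⟩
  map (λ g → inv σ + countᵇ (g ≤ᵇ_) (upTo n)) (upTo (suc n))
    ≡⟨ map-cong (λ g → cong (inv σ +_) (countᵇ-from g n)) (upTo (suc n)) ⟩
  map (λ g → inv σ + (n ∸ g)) (upTo (suc n))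
    ↭⟨ map-upTo-reflect (inv σ +_) n ⟩
  map (inv σ +_) (upTo (suc n)) ∎
  where open PermutationReasoning

range-by-halves : ∀ (f : ℕ → ℕ) s r k →
  map f (upTo (suc r)) ↭ map (λ g → s + (suc k + g)) (upTo (suc r)) →
  map (λ j → f (suc r + j)) (upTo (suc k)) ↭ map (s +_) (upTo (suc k)) →
  map f (upTo (suc (suc r + k))) ↭ map (s +_) (upTo (suc (suc r + k)))
range-by-halves f s r k low high = begin
  map f (upTo (suc (suc r + k)))
    ≡⟨ cong (λ n → map f (upTo n)) (+-suc (suc r) k) ⟨
  map f (upTo (suc r + suc k))
    ≡⟨ map-upTo-+ f (suc r) (suc k) ⟩
  map f (upTo (suc r)) ++ map (λ j → f (suc r + j)) (upTo (suc k))
    ↭⟨ ++⁺ low high ⟩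
  map (λ g → s + (suc k + g)) (upTo (suc r)) ++ map (s +_) (upTo (suc k))
    ↭⟨ ++-comm (map (λ g → s + (suc k + g)) (upTo (suc r))) (map (s +_) (upTo (suc k))) ⟩
  map (s +_) (upTo (suc k)) ++ map (λ g → s + (suc k + g)) (upTo (suc r))
    ≡⟨ map-upTo-+ (s +_) (suc k) (suc r) ⟨
  map (s +_) (upTo (suc k + suc r))
    ≡⟨ cong (λ n → map (s +_) (upTo n)) (trans (+-comm (suc k) (suc r)) (+-suc (suc r) k)) ⟩
  map (s +_) (upTo (suc (suc r + k))) ∎
  where open PermutationReasoning

rangeIncrementing-byLast : ∀ st → st [ 0 ] ≡ st [] →
  (∀ {u r k} → u ∷ʳ r ↭ upTo (suc r + k) → HasRangeIncrements st (suc r + k) (u ∷ʳ r)) → RangeIncrementing st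
rangeIncrementing-byLast st base step {zero} σ↭ with ↭-empty-inv σ↭
... | refl = ↭-reflexive (cong [_] (trans base (sym (+-identityʳ (st [])))))
rangeIncrementing-byLast st base step {suc m} {σ} σ↭ with initLast σ
... | [] = contradiction (↭-length σ↭) (λ ())
... | u ∷ʳ′ r = subst (λ m → u ∷ʳ r ↭ upTo (suc m) → HasRangeIncrements st (suc m) (u ∷ʳ r))
  (m+[n∸m]≡n r≤m) step σ↭
  where
  r≤m : r ≤ m
  r≤m = ≤-pred (∈-upTo⁻ (∈-resp-↭ σ↭ (∈-++⁺ʳ u (here refl))))

+₄-cong : ∀ {a b c d a′ b′ c′ d′ : ℕ} → a ≡ a′ → b ≡ b′ → c ≡ c′ → d ≡ d′ → a + b + c + d ≡ a′ + b′ + c′ + d′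
+₄-cong refl refl refl refl = refl

module LastValue {u : List ℕ} {r k : ℕ} (σ↭ : u ∷ʳ r ↭ upTo (suc r + k)) where

  σ : List ℕ
  σ = u ∷ʳ r

  countᵇ-init : ∀ {P} → P r ≡ false → countᵇ P u ≡ countᵇ P (upTo (suc r + k))
  countᵇ-init {P} Pr≡f = begin
    countᵇ P u                   ≡⟨ +-identityʳ _ ⟨
    countᵇ P u + 0               ≡⟨ cong (λ b → countᵇ P u + b2n b) Pr≡f ⟨
    countᵇ P u + b2n (P r)       ≡⟨ countᵇ-∷ʳ P u r ⟨
    countᵇ P σ                   ≡⟨ countᵇ-↭ P σ↭ ⟩
    countᵇ P (upTo (suc r + k))  ∎
    where open ≡-Reasoning

  r≤n : r ≤ suc r + k
  r≤n = ≤-trans (n≤1+n r) (m≤m+n (suc r) k)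

  module Low {g : ℕ} (g≤r : g ≤ r) where

    a-cb-grows : a-cb (extend σ g) ≡ a-cb σ + g
    a-cb-grows = trans (a-cb-extend u r g) (cong (a-cb σ +_) (begin
      countᵇ (λ x → (x <ᵇ g) ∧ (g ≤ᵇ r)) u  ≡⟨ countᵇ-∧-trueʳ (_<ᵇ g) u (≤ᵇ-true g≤r) ⟩
      countᵇ (_<ᵇ g) u                     ≡⟨ countᵇ-init (<ᵇ-false g≤r) ⟩
      countᵇ (_<ᵇ g) (upTo (suc r + k))    ≡⟨ countᵇ-between 0 (≤-trans g≤r r≤n) ⟩
      g                                    ∎))
      where open ≡-Reasoning

    b-ac-grows : b-ac (extend σ g) ≡ b-ac σ + 0
    b-ac-grows = trans (b-ac-extend u r g) (cong (b-ac σ +_) (begin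
      countᵇ (λ x → (r <ᵇ x) ∧ (x <ᵇ g)) u                     ≡⟨ countᵇ-init (cong (_∧ (r <ᵇ g)) (<ᵇ-irrefl r)) ⟩
      countᵇ (λ x → (suc r ≤ᵇ x) ∧ (x <ᵇ g)) (upTo (suc r + k)) ≡⟨ countᵇ-between (suc r) (≤-trans g≤r r≤n) ⟩
      g ∸ suc r                                                ≡⟨ m≤n⇒m∸n≡0 (m≤n⇒m≤1+n g≤r) ⟩
      0                                                        ∎))
      where open ≡-Reasoning

    c-ba-grows : c-ba (extend σ g) ≡ c-ba σ + k
    c-ba-grows = trans (c-ba-extend u r g) (cong (c-ba σ +_) (begin
      countᵇ (λ x → (g ≤ᵇ r) ∧ (r <ᵇ x)) u   ≡⟨ countᵇ-cong u (λ x → cong (_∧ (r <ᵇ x)) (≤ᵇ-true g≤r)) ⟩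
      countᵇ (suc r ≤ᵇ_) u                  ≡⟨ countᵇ-init (<ᵇ-irrefl r) ⟩
      countᵇ (suc r ≤ᵇ_) (upTo (suc r + k)) ≡⟨ countᵇ-from (suc r) (suc r + k) ⟩
      suc r + k ∸ suc r                     ≡⟨ m+n∸m≡n (suc r) k ⟩
      k                                     ∎))
      where open ≡-Reasoning

    b-ca-grows : b-ca (extend σ g) ≡ b-ca σ + (r ∸ g)
    b-ca-grows = trans (b-ca-extend u r g) (cong (b-ca σ +_)
      (trans (countᵇ-init (trans (cong ((g ≤ᵇ r) ∧_) (<ᵇ-irrefl r)) (∧-zeroʳ _))) (countᵇ-between g r≤n)))

    c-ab-grows : c-ab (extend σ g) ≡ c-ab σ + 0
    c-ab-grows = trans (c-ab-extend u r g) (cong (c-ab σ +_) (countᵇ-∧-falseˡ (g ≤ᵇ_) u (<ᵇ-false g≤r)))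

    ba-grows : ba (extend σ g) ≡ ba σ + 1
    ba-grows = trans (ba-extend u r g) (cong (λ b → ba σ + b2n b) (≤ᵇ-true g≤r))

  module High {j : ℕ} (j≤k : j ≤ k) where

    g : ℕ
    g = suc r + j

    r<g : r < g
    r<g = m≤m+n (suc r) j

    a-cb-grows : a-cb (extend σ g) ≡ a-cb σ + 0
    a-cb-grows = trans (a-cb-extend u r g) (cong (a-cb σ +_) (countᵇ-∧-falseʳ (_<ᵇ g) u (≤ᵇ-false r<g)))

    b-ac-grows : b-ac (extend σ g) ≡ b-ac σ + j
    b-ac-grows = trans (b-ac-extend u r g) (cong (b-ac σ +_) (begin
      countᵇ (λ x → (r <ᵇ x) ∧ (x <ᵇ g)) u                     ≡⟨ countᵇ-init (cong (_∧ (r <ᵇ g)) (<ᵇ-irrefl r)) ⟩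
      countᵇ (λ x → (suc r ≤ᵇ x) ∧ (x <ᵇ g)) (upTo (suc r + k)) ≡⟨ countᵇ-between (suc r) (+-monoʳ-≤ (suc r) j≤k) ⟩
      suc r + j ∸ suc r                                        ≡⟨ m+n∸m≡n (suc r) j ⟩
      j                                                        ∎))
      where open ≡-Reasoning

    c-ba-grows : c-ba (extend σ g) ≡ c-ba σ + 0
    c-ba-grows = trans (c-ba-extend u r g) (cong (c-ba σ +_) (countᵇ-∧-falseˡ (r <ᵇ_) u (≤ᵇ-false r<g)))

    b-ca-grows : b-ca (extend σ g) ≡ b-ca σ + 0
    b-ca-grows = trans (b-ca-extend u r g) (cong (b-ca σ +_) (begin
      countᵇ (λ x → (g ≤ᵇ x) ∧ (x <ᵇ r)) u                 ≡⟨ countᵇ-init (trans (cong ((g ≤ᵇ r) ∧_) (<ᵇ-irrefl r)) (∧-zeroʳ _)) ⟩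
      countᵇ (λ x → (g ≤ᵇ x) ∧ (x <ᵇ r)) (upTo (suc r + k)) ≡⟨ countᵇ-between g r≤n ⟩
      r ∸ g                                                 ≡⟨ m≤n⇒m∸n≡0 (<⇒≤ r<g) ⟩
      0                                                     ∎))
      where open ≡-Reasoning

    c-ab-grows : c-ab (extend σ g) ≡ c-ab σ + (k ∸ j)
    c-ab-grows = trans (c-ab-extend u r g) (cong (c-ab σ +_) (begin
      countᵇ (λ x → (r <ᵇ g) ∧ (g ≤ᵇ x)) u   ≡⟨ countᵇ-cong u (λ x → cong (_∧ (g ≤ᵇ x)) (<ᵇ-true r<g)) ⟩
      countᵇ (g ≤ᵇ_) u                      ≡⟨ countᵇ-init (≤ᵇ-false r<g) ⟩
      countᵇ (g ≤ᵇ_) (upTo (suc r + k))     ≡⟨ countᵇ-from g (suc r + k) ⟩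
      suc r + k ∸ (suc r + j)               ≡⟨ [m+n]∸[m+o]≡n∸o (suc r) k j ⟩
      k ∸ j                                 ∎))
      where open ≡-Reasoning

    ba-grows : ba (extend σ g) ≡ ba σ + 0
    ba-grows = trans (ba-extend u r g) (cong (λ b → ba σ + b2n b) (≤ᵇ-false r<g))

  low-arith : ∀ a b c d x k → a + x + (b + 0) + (c + k) + (d + 1) ≡ a + b + c + d + (suc k + x)
  low-arith = solve-∀

  high-arith : ∀ a b c d x → a + 0 + (b + x) + (c + 0) + (d + 0) ≡ a + b + c + d + x
  high-arith = solve-∀

  stat1-low : ∀ {g} → g ≤ r → stat1 (extend σ g) ≡ stat1 σ + (suc k + g)
  stat1-low {g} g≤r = trans (+₄-cong a-cb-grows b-ac-grows c-ba-grows ba-grows) (low-arith (a-cb σ) (b-ac σ) (c-ba σ) (ba σ) g k)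
    where open Low g≤r

  stat1-high : ∀ {j} → j ≤ k → stat1 (extend σ (suc r + j)) ≡ stat1 σ + j
  stat1-high {j} j≤k = trans (+₄-cong a-cb-grows b-ac-grows c-ba-grows ba-grows) (high-arith (a-cb σ) (b-ac σ) (c-ba σ) (ba σ) j)
    where open High j≤k

  stat2-low : ∀ {g} → g ≤ r → stat2 (extend σ g) ≡ stat2 σ + (suc k + (r ∸ g))
  stat2-low {g} g≤r = trans (+₄-cong b-ac-grows b-ca-grows c-ba-grows ba-grows) (arith (b-ac σ) (b-ca σ) (c-ba σ) (ba σ) (r ∸ g) k)
    where
    open Low g≤r
    arith : ∀ a b c d x k → a + 0 + (b + x) + (c + k) + (d + 1) ≡ a + b + c + d + (suc k + x)
    arith = solve-∀

  stat2-high : ∀ {j} → j ≤ k → stat2 (extend σ (suc r + j)) ≡ stat2 σ + j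
  stat2-high {j} j≤k = trans (+₄-cong b-ac-grows b-ca-grows c-ba-grows ba-grows) (arith (b-ac σ) (b-ca σ) (c-ba σ) (ba σ) j)
    where
    open High j≤k
    arith : ∀ a b c d x → a + x + (b + 0) + (c + 0) + (d + 0) ≡ a + b + c + d + x
    arith = solve-∀

  stat3-low : ∀ {g} → g ≤ r → stat3 (extend σ g) ≡ stat3 σ + (suc k + g)
  stat3-low {g} g≤r = trans (+₄-cong a-cb-grows c-ab-grows c-ba-grows ba-grows) (low-arith (a-cb σ) (c-ab σ) (c-ba σ) (ba σ) g k)
    where open Low g≤r

  stat3-high : ∀ {j} → j ≤ k → stat3 (extend σ (suc r + j)) ≡ stat3 σ + (k ∸ j)
  stat3-high {j} j≤k = trans (+₄-cong a-cb-grows c-ab-grows c-ba-grows ba-grows) (high-arith (a-cb σ) (c-ab σ) (c-ba σ) (ba σ) (k ∸ j))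
    where open High j≤k

stat1-rangeIncrementing : RangeIncrementing stat1
stat1-rangeIncrementing = rangeIncrementing-byLast stat1 refl λ {u} {r} {k} σ↭ → let open LastValue σ↭ in
  range-by-halves (λ g → stat1 (extend σ g)) (stat1 σ) r k
    (↭-reflexive (map-cong-upTo (suc r) (λ g<1+r → stat1-low (≤-pred g<1+r))))
    (↭-reflexive (map-cong-upTo (suc k) (λ j<1+k → stat1-high (≤-pred j<1+k))))

stat2-rangeIncrementing : RangeIncrementing stat2
stat2-rangeIncrementing = rangeIncrementing-byLast stat2 refl λ {u} {r} {k} σ↭ → let open LastValue σ↭ in
  range-by-halves (λ g → stat2 (extend σ g)) (stat2 σ) r k
    (↭-trans (↭-reflexive (map-cong-upTo (suc r) (λ g<1+r → stat2-low (≤-pred g<1+r))))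
             (map-upTo-reflect (λ t → stat2 σ + (suc k + t)) r))
    (↭-reflexive (map-cong-upTo (suc k) (λ j<1+k → stat2-high (≤-pred j<1+k))))

stat3-rangeIncrementing : RangeIncrementing stat3
stat3-rangeIncrementing = rangeIncrementing-byLast stat3 refl λ {u} {r} {k} σ↭ → let open LastValue σ↭ in
  range-by-halves (λ g → stat3 (extend σ g)) (stat3 σ) r k
    (↭-reflexive (map-cong-upTo (suc r) (λ g<1+r → stat3-low (≤-pred g<1+r))))
    (↭-trans (↭-reflexive (map-cong-upTo (suc k) (λ j<1+k → stat3-high (≤-pred j<1+k))))
             (map-upTo-reflect (stat3 σ +_) k))

-- 𝔖ₙ enumerated by extensions

perms : ℕ → List (List ℕ)
perms zero    = [ [] ]
perms (suc n) = cartesianProductWith extend (perms n) (upTo (suc n))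

extend-upTo : ∀ {g n} → g ≤ n → extend (upTo n) g ↭ upTo (suc n)
extend-upTo {zero} {n} _ = begin
  map suc (upTo n) ∷ʳ 0  ↭⟨ ∷↭∷ʳ 0 (map suc (upTo n)) ⟨
  0 ∷ map suc (upTo n)   ≡⟨ upTo-suc n ⟨
  upTo (suc n)           ∎
  where open PermutationReasoning
extend-upTo {suc g} {suc n} (s≤s g≤n) = begin
  extend (upTo (suc n)) (suc g)
    ≡⟨ cong (λ xs → extend xs (suc g)) (upTo-suc n) ⟩
  0 ∷ map (punchIn (suc g)) (map suc (upTo n)) ∷ʳ suc g
    ≡⟨ cong (λ xs → 0 ∷ xs ∷ʳ suc g) (trans (sym (map-∘ (upTo n))) (map-∘ (upTo n))) ⟩
  0 ∷ map suc (map (punchIn g) (upTo n)) ∷ʳ suc g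
    ≡⟨ cong (0 ∷_) (map-++ suc (map (punchIn g) (upTo n)) [ g ]) ⟨
  0 ∷ map suc (extend (upTo n) g)
    ↭⟨ ↭-prep 0 (map⁺ suc (extend-upTo g≤n)) ⟩
  0 ∷ map suc (upTo (suc n))
    ≡⟨ upTo-suc (suc n) ⟨
  upTo (suc (suc n)) ∎
  where open PermutationReasoning

extend-↭ : ∀ {σ n g} → σ ↭ upTo n → g ≤ n → extend σ g ↭ upTo (suc n)
extend-↭ {g = g} σ↭ g≤n = ↭-trans (++⁺ʳ [ g ] (map⁺ (punchIn g) σ↭)) (extend-upTo g≤n)

∈perms⇒↭upTo : ∀ n {σ} → σ ∈ perms n → σ ↭ upTo n
∈perms⇒↭upTo zero    (here refl) = ↭-refl
∈perms⇒↭upTo (suc n) σ∈ with ∈-cartesianProductWith⁻ extend (perms n) (upTo (suc n)) σ∈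
... | τ , g , τ∈ , g∈ , refl = extend-↭ (∈perms⇒↭upTo n τ∈) (≤-pred (∈-upTo⁻ g∈))

map-extensions : ∀ st {n} xs → All (HasRangeIncrements st n) xs →
  map st (cartesianProductWith extend xs (upTo (suc n))) ↭ cartesianProductWith _+_ (map st xs) (upTo (suc n))
map-extensions st []       []           = ↭-refl
map-extensions st {n} (σ ∷ xs) (σ-inc ∷ xs-inc) = begin
  map st (map (extend σ) (upTo (suc n)) ++ cartesianProductWith extend xs (upTo (suc n)))
    ≡⟨ map-++ st (map (extend σ) (upTo (suc n))) _ ⟩
  map st (map (extend σ) (upTo (suc n))) ++ map st (cartesianProductWith extend xs (upTo (suc n)))
    ≡⟨ cong₂ _++_ (map-∘ (upTo (suc n))) refl ⟨
  map (λ g → st (extend σ g)) (upTo (suc n)) ++ map st (cartesianProductWith extend xs (upTo (suc n)))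
    ↭⟨ ++⁺ σ-inc (map-extensions st xs xs-inc) ⟩
  map (st σ +_) (upTo (suc n)) ++ cartesianProductWith _+_ (map st xs) (upTo (suc n)) ∎
  where open PermutationReasoning

perms-equidistributed : ∀ {s t} → RangeIncrementing s → RangeIncrementing t → s [] ≡ t [] →
  ∀ n → map s (perms n) ↭ map t (perms n)
perms-equidistributed s-inc t-inc s≡t zero    = ↭-reflexive (cong [_] s≡t)
perms-equidistributed {s} {t} s-inc t-inc s≡t (suc n) = begin
  map s (perms (suc n))
    ↭⟨ map-extensions s (perms n) (incs s-inc) ⟩
  cartesianProductWith _+_ (map s (perms n)) (upTo (suc n))
    ↭⟨ cartesianProductWith-↭ˡ _+_ (upTo (suc n)) (perms-equidistributed s-inc t-inc s≡t n) ⟩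
  cartesianProductWith _+_ (map t (perms n)) (upTo (suc n))
    ↭⟨ map-extensions t (perms n) (incs t-inc) ⟨
  map t (perms (suc n)) ∎
  where
  open PermutationReasoning
  incs : ∀ {st} → RangeIncrementing st → All (HasRangeIncrements st n) (perms n)
  incs st-inc = All.tabulate (λ σ∈ → st-inc (∈perms⇒↭upTo n σ∈))

extend-injective : ∀ {σ τ g h} → extend σ g ≡ extend τ h → σ ≡ τ × g ≡ h
extend-injective {σ} {τ} eq with ∷ʳ-injective (map (punchIn _) σ) (map (punchIn _) τ) eq
... | map≡ , refl = map-injective (punchIn-injective _) map≡ , refl

unique-perms : ∀ n → Unique (perms n)
unique-perms zero    = [] ∷ []
unique-perms (suc n) = UniqueP.cartesianProductWith⁺ extend extend-injective (unique-perms n) (UniqueP.upTo⁺ (suc n))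

IsPerm : ℕ → List ℕ → Set
IsPerm n w = length w ≡ n × All (_< n) w × Unique w

IsPerm-upTo : ∀ n → IsPerm n (upTo n)
IsPerm-upTo n = length-upTo n , AllP.applyUpTo⁺₁ (λ i → i) n (λ i<n → i<n) , UniqueP.upTo⁺ n

IsPerm-resp-↭ : ∀ {n w w′} → w ↭ w′ → IsPerm n w → IsPerm n w′
IsPerm-resp-↭ w↭ (len , bounded , unique) =
  trans (sym (↭-length w↭)) len , All-resp-↭ w↭ bounded , Unique-resp-↭ (↭⇒↭ₛ w↭) unique

punchOut-last : ∀ {m u g} → IsPerm (suc m) (u ∷ʳ g) →
  g < suc m × IsPerm m (map (punchOut g) u) × extend (map (punchOut g) u) g ≡ u ∷ʳ g
punchOut-last {m} {u} {g} perm with IsPerm-resp-↭ (↭-sym (∷↭∷ʳ g u)) perm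
... | len , g<1+m ∷ u<1+m , g∉u ∷ u-unique = g<1+m , τ-perm , cong (_∷ʳ g) punchIn-τ
  where
  u≢g : All (_≢ g) u
  u≢g = All.map (λ g≢x x≡g → g≢x (sym x≡g)) g∉u

  punchIn-τ : map (punchIn g) (map (punchOut g) u) ≡ u
  punchIn-τ = trans (sym (map-∘ u)) (trans (map-cong-local (All.map punchIn-punchOut u≢g)) (map-id u))

  τ-perm : IsPerm m (map (punchOut g) u)
  τ-perm = trans (length-map (punchOut g) u) (suc-injective len)
         , AllP.map⁺ (All.zipWith (λ (x<1+m , x≢g) → punchOut-< g<1+m x<1+m x≢g) (u<1+m , u≢g))
         , UniqueP.map⁻ (subst Unique (sym punchIn-τ) u-unique)

IsPerm⇒∈perms : ∀ n {w} → IsPerm n w → w ∈ perms n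
IsPerm⇒∈perms zero    {[]} _    = here refl
IsPerm⇒∈perms (suc m) {w}  perm with initLast w
... | []     = contradiction (proj₁ perm) (λ ())
... | u ∷ʳ′ g with punchOut-last perm
...   | g<1+m , τ-perm , extend≡ = subst (_∈ perms (suc m)) extend≡
  (∈-cartesianProductWith⁺ extend (IsPerm⇒∈perms m τ-perm) (∈-upTo⁺ g<1+m))

-- The enumeration agrees with Sym

∈-words : ∀ {n m} (v : Vec (Fin n) m) → v ∈ words n m
∈-words []      = here refl
∈-words {n} {suc m} (x ∷ v) = subst (x ∷ v ∈_) (sym (concatMap-map≡cartesianProductWith _∷_ (allFin n) (words n m)))
  (∈-cartesianProductWith⁺ _∷_ (∈-allFin x) (∈-words v))

unique-words : ∀ n m → Unique (words n m)
unique-words n zero    = [] ∷ []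
unique-words n (suc m) = subst Unique (sym (concatMap-map≡cartesianProductWith _∷_ (allFin n) (words n m)))
  (UniqueP.cartesianProductWith⁺ _∷_ VecP.∷-injective (UniqueP.allFin⁺ n) (unique-words n m))

toℕs : ∀ {n m} → Vec (Fin n) m → List ℕ
toℕs v = Vec.toList (Vec.map toℕ v)

toℕs-injective : ∀ {n m} {v v′ : Vec (Fin n) m} → toℕs v ≡ toℕs v′ → v ≡ v′
toℕs-injective {v = []}    {[]}     _  = refl
toℕs-injective {v = x ∷ v} {y ∷ v′} eq with ∷-injective eq
... | x≡y , v≡v′ = cong₂ _∷_ (FinP.toℕ-injective x≡y) (toℕs-injective v≡v′)

toℕs-< : ∀ {n m} (v : Vec (Fin n) m) → All (_< n) (toℕs v)
toℕs-< []      = []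
toℕs-< (x ∷ v) = FinP.toℕ<n x ∷ toℕs-< v

toℕs-surjective : ∀ {n} m {w} → length w ≡ m → All (_< n) w → ∃ λ (v : Vec (Fin n) m) → toℕs v ≡ w
toℕs-surjective zero    {[]}    _   []             = [] , refl
toℕs-surjective (suc m) {x ∷ w} len (x<n ∷ bounded) with toℕs-surjective m (suc-injective len) bounded
... | v , refl = fromℕ< x<n ∷ v , cong (_∷ toℕs v) (FinP.toℕ-fromℕ< x<n)

distinct⇒Unique : ∀ w → T (distinct w) → Unique w
distinct⇒Unique []      _ = []
distinct⇒Unique (x ∷ w) d with Equivalence.to T-∧ d
... | x-new , w-distinct = All.map T-not-≡ᵇ⇒≢ (AllP.all⁺ (λ y → not (x ≡ᵇ y)) w x-new) ∷ distinct⇒Unique w w-distinct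

Unique⇒distinct : ∀ {w} → Unique w → T (distinct w)
Unique⇒distinct {[]}    []               = tt
Unique⇒distinct {x ∷ w} (x∉w ∷ w-unique) =
  Equivalence.from T-∧ (AllP.all⁻ (λ y → not (x ≡ᵇ y)) (All.map ≢⇒T-not-≡ᵇ x∉w) , Unique⇒distinct w-unique)

distinct? : (w : List ℕ) → Dec (distinct w ≡ true)
distinct? w = distinct w Bool.≟ true

∈Sym⇒IsPerm : ∀ n {w} → w ∈ Sym n → IsPerm n w
∈Sym⇒IsPerm n w∈ with ∈-filter⁻ distinct? {xs = map oneLine (words n n)} w∈
... | w∈words , w-distinct with ∈-map⁻ oneLine w∈words
...   | v , _ , refl =
  VecP.length-toList (Vec.map toℕ v) , toℕs-< v , distinct⇒Unique _ (Equivalence.from T-≡ w-distinct)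

IsPerm⇒∈Sym : ∀ n {w} → IsPerm n w → w ∈ Sym n
IsPerm⇒∈Sym n (len , bounded , unique) with toℕs-surjective n len bounded
... | v , refl = ∈-filter⁺ distinct? (∈-map⁺ oneLine (∈-words v)) (Equivalence.to T-≡ (Unique⇒distinct unique))

unique-Sym : ∀ n → Unique (Sym n)
unique-Sym n = UniqueP.filter⁺ distinct? (UniqueP.map⁺ toℕs-injective (unique-words n n))

Sym↭perms : ∀ n → Sym n ↭ perms n
Sym↭perms n = ∼bag⇒↭ (unique∧set⇒bag (unique-Sym n) (unique-perms n) (mk⇔
  (IsPerm⇒∈perms n ∘ ∈Sym⇒IsPerm n)
  (λ w∈ → IsPerm⇒∈Sym n (IsPerm-resp-↭ (↭-sym (∈perms⇒↭upTo n w∈)) (IsPerm-upTo n)))))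

count-via-perms : ∀ st n k → count st n k ≡ length (filter (λ v → ℤ.+ v ℤ≟ k) (map st (perms n)))
count-via-perms st n k = trans (↭-length (filter-↭ (λ w → ℤ.+ st w ℤ≟ k) (Sym↭perms n)))
  (length-filter-map (λ v → ℤ.+ v ℤ≟ k) st (perms n))

-- The statement holds for n = 0 as well, so the hypothesis 1 ≤ n is ignored.
mahonian : ∀ {st} → RangeIncrementing st → st [] ≡ 0 → Mahonian st
mahonian {st} st-inc st[]≡0 n _ k = begin
  count st n k
    ≡⟨ count-via-perms st n k ⟩
  length (filter (λ v → ℤ.+ v ℤ≟ k) (map st (perms n)))
    ≡⟨ ↭-length (filter-↭ _ (perms-equidistributed st-inc inv-rangeIncrementing st[]≡0 n)) ⟩
  length (filter (λ v → ℤ.+ v ℤ≟ k) (map inv (perms n)))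
    ≡⟨ count-via-perms inv n k ⟨
  count inv n k ∎
  where open ≡-Reasoning

theorem3 : Mahonian stat1 × Mahonian stat2 × Mahonian stat3
theorem3 = mahonian stat1-rangeIncrementing refl
         , mahonian stat2-rangeIncrementing refl
         , mahonian stat3-rangeIncrementing refl
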